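{- Let $n\geq 3$, $D=\{1\leq i\leq 2^{n+1}-3,\ i\text{ odd}\}$, and let $U$ be a solution of the modular system associated to $D$ and $p=2$, of length $\ell$ and weight $w$, whose support has exactly $w$ jumps. Write the support, up to a cyclic shift of indices, as the sequence $$n_1,2n_1,\ldots,2^{\ell_1-1}n_1,\ n_2,\ldots,2^{\ell_2-1}n_2,\ \ldots,\ n_w,\ldots,2^{\ell_w-1}n_w$$ (block indices taken modulo $w$). Assume $n_k>2^u$ for some positive integer $u$ and some $k$. Then at least one of the following holds: (i) $\ell_k\leq n-u$; (ii) $\ell_k+\ell_{k+1}\leq n+1$.
   Context: For $\ell\geq1$, $E_{D,2}(\ell)$ is the set of tuples $U=(u_d)_{d\in D}\in\{0,\dots,2^\ell-1\}^{|D|}$ with $\sum_D du_d\equiv 0\pmod{2^\ell-1}$ and $\sum_D du_d>0$; such $U$ has length $\ell$ and weight $w=\sum_D s_2(u_d)$ ($s_2$ = sum of binary digits). The shift $\delta$ on $\{0,\dots,2^\ell-1\}$ fixes $2^\ell-1$ and sends any other $i$ to $2i \bmod (2^\ell-1)$, acting coordinatewise. The support is $\varphi_U:\mathbb{Z}/\ell\mathbb{Z}\to\mathbb{N}_{>0}$, $\varphi_U(k)=\frac{1}{2^\ell-1}\sum_D d\,\delta^k(u_d)$; one always has $\varphi_U(i+1)\leq 2\varphi_U(i)$, and a jump is an $i$ with $\varphi_U(i+1)<2\varphi_U(i)$. With exactly $w$ jumps, the support decomposes cyclically into $w$ maximal geometric blocks of ratio $2$ as written, with $\ell_1+\dots+\ell_w=\ell$.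 -}

module Defs where

open import Data.Nat using (ℕ; zero; suc; _+_; _*_; _∸_; _^_; _≤_; _<_; _<ᵇ_; _≟_)
open import Data.Nat.DivMod using (_/_; _%_)
open import Data.Nat.Divisibility using (_∣_)
open import Data.Fin using (Fin; toℕ)
open import Data.Bool using (if_then_else_)
open import Relation.Nullary using (yes; no)

sumUpTo : ℕ → (ℕ → ℕ) → ℕ
sumUpTo zero    f = 0
sumUpTo (suc k) f = sumUpTo k f + f k

sumFin : (m : ℕ) → (Fin m → ℕ) → ℕ
sumFin zero    f = 0
sumFin (suc m) f = f Fin.zero + sumFin m (λ i → f (Fin.suc i))

-- sum of binary digits s₂ (fuel = m itself suffices, since m halves each step)
s₂-fuel : ℕ → ℕ → ℕ
s₂-fuel zero    m = 0
s₂-fuel (suc f) m = m % 2 + s₂-fuel f (m / 2)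

s₂ : ℕ → ℕ
s₂ m = s₂-fuel m m

mersenne : ℕ → ℕ
mersenne ℓ = 2 ^ ℓ ∸ 1

-- quotient, with the (unused) convention m / 0 = 0
quot : ℕ → ℕ → ℕ
quot m zero    = 0
quot m (suc q) = m / suc q

-- D = { 1 ≤ d ≤ 2^(n+1) - 3, d odd } has 2^n - 1 elements;
-- it is enumerated as d_i = 2 i + 1 for i : Fin (2^n - 1).
Dsize : ℕ → ℕ
Dsize n = 2 ^ n ∸ 1

dElem : {n : ℕ} → Fin (Dsize n) → ℕ
dElem i = 2 * toℕ i + 1

Tuple : ℕ → Set
Tuple n = Fin (Dsize n) → ℕ

dSum : (n : ℕ) → Tuple n → ℕ
dSum n U = sumFin (Dsize n) (λ i → dElem {n} i * U i)

InE : (n ℓ : ℕ) → Tuple n → Set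
InE n ℓ U = ((i : Fin (Dsize n)) → U i ≤ mersenne ℓ)
          × (mersenne ℓ ∣ dSum n U)
          × (0 < dSum n U)
  where open import Data.Product using (_×_)

weight : (n : ℕ) → Tuple n → ℕ
weight n U = sumFin (Dsize n) (λ i → s₂ (U i))

δ : ℕ → ℕ → ℕ
δ ℓ i with i ≟ mersenne ℓ
... | yes _ = i
... | no  _ = (2 * i) % suc (mersenne ℓ ∸ 1)
-- note: for ℓ ≥ 1, suc (mersenne ℓ ∸ 1) = mersenne ℓ

δ^ : ℕ → ℕ → ℕ → ℕ
δ^ ℓ zero    i = i
δ^ ℓ (suc k) i = δ ℓ (δ^ ℓ k i)

-- support φ_U(k) = (1/(2^ℓ-1)) Σ_D d δ^k(u_d), defined for all k : ℕ
-- (periodic of period ℓ, so this is φ_U on ℤ/ℓℤ read through k mod ℓ)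
φ : (n ℓ : ℕ) → Tuple n → ℕ → ℕ
φ n ℓ U k = quot (sumFin (Dsize n) (λ i → dElem {n} i * δ^ ℓ k (U i))) (mersenne ℓ)

jumpCount : (n ℓ : ℕ) → Tuple n → ℕ
jumpCount n ℓ U =
  sumUpTo ℓ (λ i → if φ n ℓ U (suc i) <ᵇ 2 * φ n ℓ U i then 1 else 0)

nextIdx : ℕ → ℕ → ℕ
nextIdx w k with suc k ≟ w
... | yes _ = 0
... | no  _ = suc k

{-# OPTIONS --safe #-}
-- Write 2 v = δ v + (2^ℓ − 1) · carry v with carry v ∈ {0,1}. Summing d · δ^i(u_d) over D
-- gives φ(i+1) = 2 φ(i) − E i, where E i = Σ_D d · carry (δ^i u_d), and the carries of
-- u along one period are exactly its binary digits, so the total number of carries over a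
-- period is the weight w. A jump at i forces a carry at i; with exactly w jumps there is
-- therefore at most one carry at each i, so E i ≤ max D < 2^(n+1). Periodicity then gives
-- φ < 2^(n+1) everywhere, since otherwise φ would strictly increase forever.
-- The last term 2^(ℓ_k − 1) n_k of block k is below 2^(n+1), which with n_k > 2^u gives
-- ℓ_k ≤ n + 1 − u. If (i) fails this bound is tight, so the first term of the next block
-- satisfies n_{k+1} = 2^ℓ_k n_k − E > 2^ℓ_k n_k − 2^(n+1) ≥ 2^ℓ_k, and then the bound
-- 2^(ℓ_{k+1} − 1) n_{k+1} < 2^(n+1) on the last term of block k+1 gives ℓ_k + ℓ_{k+1} ≤ n + 1.
module Submission where

open import Defs
open import Data.Nat using (ℕ; _+_; _*_; _∸_; _^_; _≤_; _<_)
open import Data.Sum using (_⊎_)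
open import Relation.Binary.PropositionalEquality using (_≡_)

open import Data.Bool using (true; false; T; if_then_else_)
open import Data.Empty using (⊥-elim)
open import Data.Fin using (Fin; toℕ)
open import Data.Fin.Properties using (toℕ<n)
open import Data.Nat
  using (zero; suc; pred; NonZero; >-nonZero; >-nonZero⁻¹; z≤n; s≤s; _<ᵇ_; _≟_; _<?_; _≤?_)
open import Data.Nat.DivMod
open import Data.Nat.Divisibility using (_∣_; divides; ∣m+n∣m⇒∣n; ∣-trans; m∣m*n; n∣m*n)
open import Data.Nat.Properties
open import Data.Nat.Solver using (module +-*-Solver)
open import Data.Product using (_×_; _,_; proj₁; proj₂)
open import Data.Sum using (inj₁; inj₂; [_,_]′)
open import Data.Unit using (tt)
open import Function using (_∘_)
open import Relation.Nullary using (yes; no)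
open import Relation.Binary.PropositionalEquality
  using (refl; sym; trans; cong; cong₂; subst; subst₂; module ≡-Reasoning)

open import Algebra.Properties.CommutativeSemigroup +-commutativeSemigroup using (interchange)
open import Algebra.Properties.CommutativeSemigroup *-commutativeSemigroup
  using () renaming (x∙yz≈y∙xz to *-left-comm)
open +-*-Solver

-- Finite sums

sumFin-cong : ∀ m {f g : Fin m → ℕ} → (∀ i → f i ≡ g i) → sumFin m f ≡ sumFin m g
sumFin-cong zero    f≡g = refl
sumFin-cong (suc m) f≡g = cong₂ _+_ (f≡g Fin.zero) (sumFin-cong m (λ i → f≡g (Fin.suc i)))

sumFin-+ : ∀ m (f g : Fin m → ℕ) → sumFin m (λ i → f i + g i) ≡ sumFin m f + sumFin m g
sumFin-+ zero    f g = refl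
sumFin-+ (suc m) f g =
  trans (cong (f Fin.zero + g Fin.zero +_) (sumFin-+ m _ _))
        (interchange (f Fin.zero) (g Fin.zero) (sumFin m (f ∘ Fin.suc)) (sumFin m (g ∘ Fin.suc)))

sumFin-*ˡ : ∀ m c (f : Fin m → ℕ) → sumFin m (λ i → c * f i) ≡ c * sumFin m f
sumFin-*ˡ zero    c f = sym (*-zeroʳ c)
sumFin-*ˡ (suc m) c f =
  trans (cong (c * f Fin.zero +_) (sumFin-*ˡ m c _)) (sym (*-distribˡ-+ c _ _))

sumFin-mono-≤ : ∀ m {f g : Fin m → ℕ} → (∀ i → f i ≤ g i) → sumFin m f ≤ sumFin m g
sumFin-mono-≤ zero    f≤g = z≤n
sumFin-mono-≤ (suc m) f≤g = +-mono-≤ (f≤g Fin.zero) (sumFin-mono-≤ m (λ i → f≤g (Fin.suc i)))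

sumFin-zero : ∀ m → sumFin m (λ _ → 0) ≡ 0
sumFin-zero zero    = refl
sumFin-zero (suc m) = sumFin-zero m

sumUpTo-sumFin-comm : ∀ L m (F : ℕ → Fin m → ℕ) →
  sumUpTo L (λ j → sumFin m (F j)) ≡ sumFin m (λ i → sumUpTo L (λ j → F j i))
sumUpTo-sumFin-comm zero    m F = sym (sumFin-zero m)
sumUpTo-sumFin-comm (suc L) m F =
  trans (cong (_+ sumFin m (F L)) (sumUpTo-sumFin-comm L m F)) (sym (sumFin-+ m _ _))

sumUpTo-mono-≤ : ∀ L {f g : ℕ → ℕ} → (∀ i → i < L → f i ≤ g i) → sumUpTo L f ≤ sumUpTo L g
sumUpTo-mono-≤ zero    f≤g = z≤n
sumUpTo-mono-≤ (suc L) f≤g =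
  +-mono-≤ (sumUpTo-mono-≤ L (λ i i<L → f≤g i (m<n⇒m<1+n i<L))) (f≤g L ≤-refl)

+-mono-≤-≡⇒≡ : ∀ {a b c d} → a ≤ c → b ≤ d → a + b ≡ c + d → a ≡ c × b ≡ d
+-mono-≤-≡⇒≡ {a} {b} {c} {d} a≤c b≤d eq with m≤n⇒m<n∨m≡n a≤c
... | inj₁ a<c = ⊥-elim (<-irrefl eq (+-mono-<-≤ a<c b≤d))
... | inj₂ a≡c = a≡c , +-cancelˡ-≡ a b d (trans eq (cong (_+ d) (sym a≡c)))

sumUpTo-mono-≤-≡⇒≡ : ∀ L {f g : ℕ → ℕ} → (∀ i → i < L → f i ≤ g i) →
  sumUpTo L f ≡ sumUpTo L g → ∀ i → i < L → f i ≡ g i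
sumUpTo-mono-≤-≡⇒≡ (suc L) {f} {g} f≤g eq i i<1+L = [ below , at-L ]′ (m≤n⇒m<n∨m≡n (≤-pred i<1+L))
  where
    f≤g′ : ∀ j → j < L → f j ≤ g j
    f≤g′ j j<L = f≤g j (m<n⇒m<1+n j<L)
    split : sumUpTo L f ≡ sumUpTo L g × f L ≡ g L
    split = +-mono-≤-≡⇒≡ (sumUpTo-mono-≤ L f≤g′) (f≤g L ≤-refl) eq
    below : i < L → f i ≡ g i
    below i<L = sumUpTo-mono-≤-≡⇒≡ L f≤g′ (proj₁ split) i i<L
    at-L : i ≡ L → f i ≡ g i
    at-L i≡L = subst (λ j → f j ≡ g j) (sym i≡L) (proj₂ split)

-- Binary digit sums

s₂-fuel-zero : ∀ f → s₂-fuel f 0 ≡ 0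
s₂-fuel-zero zero    = refl
s₂-fuel-zero (suc f) = s₂-fuel-zero f

/2≤ : ∀ m f → m ≤ suc f → m / 2 ≤ f
/2≤ zero    f _      = z≤n
/2≤ (suc m) f m<2+f = ≤-pred (≤-trans (m/n<m (suc m) 2 (s≤s (s≤s z≤n))) m<2+f)

s₂-fuel-irrelevant : ∀ f g m → m ≤ f → m ≤ g → s₂-fuel f m ≡ s₂-fuel g m
s₂-fuel-irrelevant zero    g       .0 z≤n _   = sym (s₂-fuel-zero g)
s₂-fuel-irrelevant (suc f) zero    .0 _   z≤n = s₂-fuel-zero (suc f)
s₂-fuel-irrelevant (suc f) (suc g) m  m≤f m≤g =
  cong (m % 2 +_) (s₂-fuel-irrelevant f g (m / 2) (/2≤ m f m≤f) (/2≤ m g m≤g))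

s₂-unfold : ∀ m → s₂ m ≡ m % 2 + s₂ (m / 2)
s₂-unfold zero    = refl
s₂-unfold (suc m) =
  cong (suc m % 2 +_) (s₂-fuel-irrelevant m (suc m / 2) (suc m / 2) (/2≤ (suc m) m ≤-refl) ≤-refl)

s₂-2*+ : ∀ t b → b ≤ 1 → s₂ (2 * t + b) ≡ s₂ t + b
s₂-2*+ t b b≤1 = begin
  s₂ (2 * t + b)                         ≡⟨ cong s₂ (trans (+-comm (2 * t) b) (cong (b +_) (*-comm 2 t))) ⟩
  s₂ (b + t * 2)                         ≡⟨ s₂-unfold (b + t * 2) ⟩
  (b + t * 2) % 2 + s₂ ((b + t * 2) / 2) ≡⟨ cong₂ _+_ mod≡b (cong s₂ div≡t) ⟩
  b + s₂ t                               ≡⟨ +-comm b (s₂ t) ⟩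
  s₂ t + b                               ∎
  where
    open ≡-Reasoning
    b<2 : b < 2
    b<2 = s≤s b≤1
    mod≡b : (b + t * 2) % 2 ≡ b
    mod≡b = trans ([m+kn]%n≡m%n b t 2) (m<n⇒m%n≡m b<2)
    no-overflow : b % 2 + t * 2 % 2 < 2
    no-overflow = subst (_< 2) (sym (trans (cong₂ _+_ (m<n⇒m%n≡m b<2) (m*n%n≡0 t 2)) (+-identityʳ b)))
                        b<2
    div≡t : (b + t * 2) / 2 ≡ t
    div≡t = trans (+-distrib-/ b (t * 2) no-overflow) (cong₂ _+_ (m<n⇒m/n≡0 b<2) (m*n/n≡m t 2))

residue-unique : ∀ {M} a b x y → a < M → b < M → a + M * x ≡ b + M * y → a ≡ b
residue-unique {suc m} a b x y a<M b<M eq = begin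
  a                      ≡⟨ sym (m<n⇒m%n≡m a<M) ⟩
  a % suc m              ≡⟨ sym ([m+kn]%n≡m%n a x (suc m)) ⟩
  (a + x * suc m) % suc m ≡⟨ cong (λ z → (a + z) % suc m) (*-comm x (suc m)) ⟩
  (a + suc m * x) % suc m ≡⟨ cong (_% suc m) eq ⟩
  (b + suc m * y) % suc m ≡⟨ cong (λ z → (b + z) % suc m) (*-comm (suc m) y) ⟩
  (b + y * suc m) % suc m ≡⟨ [m+kn]%n≡m%n b y (suc m) ⟩
  b % suc m              ≡⟨ m<n⇒m%n≡m b<M ⟩
  b                      ∎
  where open ≡-Reasoning

quot-*≡ : ∀ s q → q ∣ s → quot s q * q ≡ s
quot-*≡ s zero    (divides k s≡k*0) = sym (trans s≡k*0 (*-zeroʳ k))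
quot-*≡ s (suc q) q∣s              = m/n*n≡m q∣s

2^-cancel-< : ∀ {a b} → 2 ^ a < 2 ^ b → a < b
2^-cancel-< {a} {b} 2^a<2^b with a <? b
... | yes a<b = a<b
... | no  a≮b = ⊥-elim (<⇒≱ 2^a<2^b (^-monoʳ-≤ 2 (≮⇒≥ a≮b)))

2^≡1+mersenne : ∀ ℓ → 2 ^ ℓ ≡ suc (mersenne ℓ)
2^≡1+mersenne ℓ = sym (m+[n∸m]≡n (m^n>0 2 ℓ))

mersenne>0 : ∀ ℓ .{{_ : NonZero ℓ}} → 0 < mersenne ℓ
mersenne>0 (suc ℓ) = ∸-monoˡ-≤ 1 (*-monoʳ-≤ 2 (m^n>0 2 ℓ))

dElem<2^[1+n] : ∀ n (d : Fin (Dsize n)) → dElem {n} d < 2 ^ suc n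
dElem<2^[1+n] n d = begin-strict
  2 * toℕ d + 1   <⟨ +-monoʳ-< (2 * toℕ d) (s≤s (s≤s z≤n)) ⟩
  2 * toℕ d + 2   ≡⟨ sym (*-distribˡ-+ 2 (toℕ d) 1) ⟩
  2 * (toℕ d + 1) ≡⟨ cong (2 *_) (+-comm (toℕ d) 1) ⟩
  2 * suc (toℕ d) ≤⟨ *-monoʳ-≤ 2 (≤-trans (toℕ<n d) (m∸n≤m (2 ^ n) 1)) ⟩
  2 * 2 ^ n       ∎
  where open ≤-Reasoning

-- The doubling map modulo 2^ℓ − 1 and its carries

carry : ℕ → ℕ → ℕ
carry ℓ v with v ≟ mersenne ℓ
... | yes _ = 1
... | no  _ = (2 * v) / suc (mersenne ℓ ∸ 1)

carries : ℕ → ℕ → ℕ → ℕ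
carries ℓ v zero    = 0
carries ℓ v (suc j) = 2 * carries ℓ v j + carry ℓ (δ^ ℓ j v)

module Shift (ℓ : ℕ) (M>0 : 0 < mersenne ℓ) where

  M : ℕ
  M = mersenne ℓ

  1+[M∸1]≡M : suc (M ∸ 1) ≡ M
  1+[M∸1]≡M = m+[n∸m]≡n M>0

  δ-carry : ∀ v → 2 * v ≡ δ ℓ v + M * carry ℓ v
  δ-carry v with v ≟ M
  ... | yes v≡M = cong (v +_) (trans (+-identityʳ v) (trans v≡M (sym (*-identityʳ M))))
  ... | no  _   = trans (m≡m%n+[m/n]*n (2 * v) (suc (M ∸ 1)))
    (cong ((2 * v) % suc (M ∸ 1) +_)
          (trans (*-comm _ (suc (M ∸ 1))) (cong (_* ((2 * v) / suc (M ∸ 1))) 1+[M∸1]≡M)))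

  δ≤M : ∀ {v} → v ≤ M → δ ℓ v ≤ M
  δ≤M {v} v≤M with v ≟ M
  ... | yes _ = v≤M
  ... | no  _ = ≤-trans (m%n≤n (2 * v) (suc (M ∸ 1))) (≤-reflexive 1+[M∸1]≡M)

  δ<M : ∀ {v} → v < M → δ ℓ v < M
  δ<M {v} v<M with v ≟ M
  ... | yes v≡M = ⊥-elim (<⇒≢ v<M v≡M)
  ... | no  _   = ≤-trans (m%n<n (2 * v) (suc (M ∸ 1))) (≤-reflexive 1+[M∸1]≡M)

  δ-M : δ ℓ M ≡ M
  δ-M with M ≟ M
  ... | yes _   = refl
  ... | no  M≢M = ⊥-elim (M≢M refl)

  carry≤1 : ∀ {v} → v ≤ M → carry ℓ v ≤ 1
  carry≤1 {v} v≤M with v ≟ M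
  ... | yes _   = ≤-refl
  ... | no  v≢M = ≤-pred (m<n*o⇒m/o<n {2 * v} {2} {suc (M ∸ 1)}
    (subst (λ K → 2 * v < 2 * K) (sym 1+[M∸1]≡M) (*-monoʳ-< 2 (≤∧≢⇒< v≤M v≢M))))

  δ^≤M : ∀ {v} j → v ≤ M → δ^ ℓ j v ≤ M
  δ^≤M zero    v≤M = v≤M
  δ^≤M (suc j) v≤M = δ≤M (δ^≤M j v≤M)

  δ^<M : ∀ {v} j → v < M → δ^ ℓ j v < M
  δ^<M zero    v<M = v<M
  δ^<M (suc j) v<M = δ<M (δ^<M j v<M)

  δ^-M : ∀ j → δ^ ℓ j M ≡ M
  δ^-M zero    = refl
  δ^-M (suc j) = trans (cong (δ ℓ) (δ^-M j)) δ-M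

  2^*≡δ^+carries : ∀ v j → 2 ^ j * v ≡ δ^ ℓ j v + M * carries ℓ v j
  2^*≡δ^+carries v zero    =
    trans (*-identityˡ v) (sym (trans (cong (v +_) (*-zeroʳ M)) (+-identityʳ v)))
  2^*≡δ^+carries v (suc j) = begin
    2 * 2 ^ j * v                 ≡⟨ *-assoc 2 (2 ^ j) v ⟩
    2 * (2 ^ j * v)               ≡⟨ cong (2 *_) (2^*≡δ^+carries v j) ⟩
    2 * (a + M * t)               ≡⟨ solve 3 (λ a M t → con 2 :* (a :+ M :* t)
                                                        := con 2 :* a :+ M :* (con 2 :* t)) refl a M t ⟩
    2 * a + M * (2 * t)           ≡⟨ cong (_+ M * (2 * t)) (δ-carry a) ⟩
    δ ℓ a + M * c + M * (2 * t)   ≡⟨ solve 4 (λ d M c t → d :+ M :* c :+ M :* (con 2 :* t)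
                                                        := d :+ M :* (con 2 :* t :+ c)) refl (δ ℓ a) M c t ⟩
    δ ℓ a + M * (2 * t + c)       ∎
    where
      open ≡-Reasoning
      a = δ^ ℓ j v
      t = carries ℓ v j
      c = carry ℓ a

  2^ℓ*≡+M* : ∀ v → 2 ^ ℓ * v ≡ v + M * v
  2^ℓ*≡+M* v = cong (_* v) (2^≡1+mersenne ℓ)

  -- For v < M the residue of 2^ℓ v = v + M v is v itself; v = M is a fixed point of δ.
  δ^-period : ∀ {v} → v ≤ M → δ^ ℓ ℓ v ≡ v
  δ^-period {v} v≤M with m≤n⇒m<n∨m≡n v≤M
  ... | inj₂ refl = δ^-M ℓ
  ... | inj₁ v<M  = sym (residue-unique v _ v (carries ℓ v ℓ) v<M (δ^<M ℓ v<M)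
                          (trans (sym (2^ℓ*≡+M* v)) (2^*≡δ^+carries v ℓ)))

  carries-period : ∀ {v} → v ≤ M → carries ℓ v ℓ ≡ v
  carries-period {v} v≤M =
    sym (*-cancelˡ-≡ v (carries ℓ v ℓ) M {{>-nonZero M>0}} (+-cancelˡ-≡ v _ _ (begin
    v + M * v                   ≡⟨ sym (2^ℓ*≡+M* v) ⟩
    2 ^ ℓ * v                   ≡⟨ 2^*≡δ^+carries v ℓ ⟩
    δ^ ℓ ℓ v + M * carries ℓ v ℓ ≡⟨ cong (_+ M * carries ℓ v ℓ) (δ^-period v≤M) ⟩
    v + M * carries ℓ v ℓ       ∎)))
    where open ≡-Reasoning

  s₂-carries : ∀ {v} j → v ≤ M → s₂ (carries ℓ v j) ≡ sumUpTo j (λ i → carry ℓ (δ^ ℓ i v))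
  s₂-carries zero    v≤M = refl
  s₂-carries {v} (suc j) v≤M =
    trans (s₂-2*+ (carries ℓ v j) _ (carry≤1 (δ^≤M j v≤M)))
          (cong (_+ carry ℓ (δ^ ℓ j v)) (s₂-carries j v≤M))

  s₂≡sum-carry : ∀ {v} → v ≤ M → s₂ v ≡ sumUpTo ℓ (λ i → carry ℓ (δ^ ℓ i v))
  s₂≡sum-carry v≤M = trans (cong s₂ (sym (carries-period v≤M))) (s₂-carries ℓ v≤M)

  δ^-+period : ∀ {v} j → v ≤ M → δ^ ℓ (j + ℓ) v ≡ δ^ ℓ j v
  δ^-+period zero    v≤M = δ^-period v≤M
  δ^-+period (suc j) v≤M = cong (δ ℓ) (δ^-+period j v≤M)

  δ^-+*period : ∀ {v} j q → v ≤ M → δ^ ℓ (j + q * ℓ) v ≡ δ^ ℓ j v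
  δ^-+*period {v} j zero    v≤M = cong (λ i → δ^ ℓ i v) (+-identityʳ j)
  δ^-+*period {v} j (suc q) v≤M = begin
    δ^ ℓ (j + (ℓ + q * ℓ)) v ≡⟨ cong (λ i → δ^ ℓ i v) (sym (+-assoc j ℓ (q * ℓ))) ⟩
    δ^ ℓ (j + ℓ + q * ℓ) v   ≡⟨ cong (λ i → δ^ ℓ (i + q * ℓ) v) (+-comm j ℓ) ⟩
    δ^ ℓ (ℓ + j + q * ℓ) v   ≡⟨ δ^-+*period (ℓ + j) q v≤M ⟩
    δ^ ℓ (ℓ + j) v           ≡⟨ cong (λ i → δ^ ℓ i v) (+-comm ℓ j) ⟩
    δ^ ℓ (j + ℓ) v           ≡⟨ δ^-+period j v≤M ⟩
    δ^ ℓ j v                 ∎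
    where open ≡-Reasoning

-- The support

-- Once a term reaches P the sequence strictly increases, which periodicity forbids.
periodic-drop-bounded : ∀ (f : ℕ → ℕ) ℓ .{{_ : NonZero ℓ}} P → (∀ j → f (j + ℓ) ≡ f j) →
  (∀ j → 2 * f j < f (suc j) + P) → ∀ j → f j < P
periodic-drop-bounded f ℓ P periodic drop j with f j <? P
... | yes fj<P = fj<P
... | no  fj≮P = ⊥-elim (<-irrefl refl
       (<-≤-trans (m<m+n (f j) (>-nonZero⁻¹ ℓ)) (≤-trans (grows ℓ) (≤-reflexive (periodic j)))))
  where
    P≤fj : P ≤ f j
    P≤fj = ≮⇒≥ fj≮P
    increases : ∀ {x} y → P ≤ x → 2 * x < y + P → x < y
    increases {x} y P≤x 2x<y+P = +-cancelʳ-< x x y (begin-strict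
      x + x       ≡⟨ cong (x +_) (sym (+-identityʳ x)) ⟩
      2 * x       <⟨ 2x<y+P ⟩
      y + P       ≤⟨ +-monoʳ-≤ y P≤x ⟩
      y + x       ∎)
      where open ≤-Reasoning
    grows : ∀ m → f j + m ≤ f (j + m)
    grows zero    = ≤-reflexive (trans (+-identityʳ _) (cong f (sym (+-identityʳ j))))
    grows (suc m) = begin
      f j + suc m        ≡⟨ +-suc (f j) m ⟩
      suc (f j + m)      ≤⟨ s≤s (grows m) ⟩
      suc (f (j + m))    ≤⟨ increases _ (≤-trans P≤fj (m+n≤o⇒m≤o (f j) (grows m))) (drop (j + m)) ⟩
      f (suc (j + m))    ≡⟨ cong f (sym (+-suc j m)) ⟩
      f (j + suc m)      ∎
      where open ≤-Reasoning

module Support (n ℓ : ℕ) .{{_ : NonZero ℓ}} (U : Tuple n) (U∈E : InE n ℓ U) where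

  open Shift ℓ (mersenne>0 ℓ)

  U≤M : ∀ d → U d ≤ M
  U≤M = proj₁ U∈E

  M∣dSum : M ∣ dSum n U
  M∣dSum = proj₁ (proj₂ U∈E)

  orbitSum : ℕ → ℕ
  orbitSum i = sumFin (Dsize n) (λ d → dElem {n} d * δ^ ℓ i (U d))

  carrySum : ℕ → ℕ
  carrySum i = sumFin (Dsize n) (λ d → dElem {n} d * carry ℓ (δ^ ℓ i (U d)))

  carryCount : ℕ → ℕ
  carryCount i = sumFin (Dsize n) (λ d → carry ℓ (δ^ ℓ i (U d)))

  jump : ℕ → ℕ
  jump i = if φ n ℓ U (suc i) <ᵇ 2 * φ n ℓ U i then 1 else 0

  orbitSum-suc : ∀ i → 2 * orbitSum i ≡ orbitSum (suc i) + M * carrySum i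
  orbitSum-suc i = begin
    2 * orbitSum i
      ≡⟨ sym (sumFin-*ˡ (Dsize n) 2 _) ⟩
    sumFin (Dsize n) (λ d → 2 * (dElem {n} d * δ^ ℓ i (U d)))
      ≡⟨ sumFin-cong (Dsize n) (λ d → weighted (dElem {n} d) (δ^ ℓ i (U d))) ⟩
    sumFin (Dsize n) (λ d → dElem {n} d * δ^ ℓ (suc i) (U d) + M * (dElem {n} d * carry ℓ (δ^ ℓ i (U d))))
      ≡⟨ sumFin-+ (Dsize n) _ _ ⟩
    orbitSum (suc i) + sumFin (Dsize n) (λ d → M * (dElem {n} d * carry ℓ (δ^ ℓ i (U d))))
      ≡⟨ cong (orbitSum (suc i) +_) (sumFin-*ˡ (Dsize n) M _) ⟩
    orbitSum (suc i) + M * carrySum i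
      ∎
    where
      open ≡-Reasoning
      weighted : ∀ d v → 2 * (d * v) ≡ d * δ ℓ v + M * (d * carry ℓ v)
      weighted d v = begin
        2 * (d * v)                    ≡⟨ *-left-comm 2 d v ⟩
        d * (2 * v)                    ≡⟨ cong (d *_) (δ-carry v) ⟩
        d * (δ ℓ v + M * carry ℓ v)    ≡⟨ *-distribˡ-+ d _ _ ⟩
        d * δ ℓ v + d * (M * carry ℓ v) ≡⟨ cong (d * δ ℓ v +_) (*-left-comm d M _) ⟩
        d * δ ℓ v + M * (d * carry ℓ v) ∎

  M∣orbitSum : ∀ i → M ∣ orbitSum i
  M∣orbitSum zero    = M∣dSum
  M∣orbitSum (suc i) = ∣m+n∣m⇒∣n M∣M*E+S′ (m∣m*n (carrySum i))
    where
      M∣M*E+S′ : M ∣ M * carrySum i + orbitSum (suc i)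
      M∣M*E+S′ = subst (M ∣_) (trans (orbitSum-suc i) (+-comm (orbitSum (suc i)) (M * carrySum i)))
                              (∣-trans (M∣orbitSum i) (n∣m*n 2))

  φ-suc : ∀ i → φ n ℓ U (suc i) + carrySum i ≡ 2 * φ n ℓ U i
  φ-suc i = *-cancelʳ-≡ _ _ M {{>-nonZero (mersenne>0 ℓ)}} (begin
    (φ n ℓ U (suc i) + carrySum i) * M   ≡⟨ *-distribʳ-+ M (φ n ℓ U (suc i)) _ ⟩
    φ n ℓ U (suc i) * M + carrySum i * M ≡⟨ cong₂ _+_ (quot-*≡ _ M (M∣orbitSum (suc i))) (*-comm _ M) ⟩
    orbitSum (suc i) + M * carrySum i    ≡⟨ sym (orbitSum-suc i) ⟩
    2 * orbitSum i                       ≡⟨ cong (2 *_) (sym (quot-*≡ _ M (M∣orbitSum i))) ⟩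
    2 * (φ n ℓ U i * M)                  ≡⟨ sym (*-assoc 2 (φ n ℓ U i) M) ⟩
    2 * φ n ℓ U i * M                    ∎)
    where open ≡-Reasoning

  φ-+period : ∀ j → φ n ℓ U (j + ℓ) ≡ φ n ℓ U j
  φ-+period j = cong (λ s → quot s M)
    (sumFin-cong (Dsize n) (λ d → cong (dElem {n} d *_) (δ^-+period j (U≤M d))))

  carrySum≤ : ∀ i → carrySum i ≤ pred (2 ^ suc n) * carryCount i
  carrySum≤ i = ≤-trans
    (sumFin-mono-≤ (Dsize n) λ d →
      *-monoˡ-≤ (carry ℓ (δ^ ℓ i (U d))) (<⇒≤pred (dElem<2^[1+n] n d)))
    (≤-reflexive (sumFin-*ˡ (Dsize n) (pred (2 ^ suc n)) _))

  carryCount-mod : ∀ i → carryCount i ≡ carryCount (i % ℓ)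
  carryCount-mod i = sumFin-cong (Dsize n) λ d → cong (carry ℓ) (begin
    δ^ ℓ i (U d)                       ≡⟨ cong (λ j → δ^ ℓ j (U d)) (m≡m%n+[m/n]*n i ℓ) ⟩
    δ^ ℓ (i % ℓ + (i / ℓ) * ℓ) (U d)   ≡⟨ δ^-+*period (i % ℓ) (i / ℓ) (U≤M d) ⟩
    δ^ ℓ (i % ℓ) (U d)                 ∎)
    where open ≡-Reasoning

  sum-carryCount≡weight : sumUpTo ℓ carryCount ≡ weight n U
  sum-carryCount≡weight = trans (sumUpTo-sumFin-comm ℓ (Dsize n) (λ j d → carry ℓ (δ^ ℓ j (U d))))
    (sumFin-cong (Dsize n) (λ d → sym (s₂≡sum-carry (U≤M d))))

  jump≤1 : ∀ i → jump i ≤ 1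
  jump≤1 i with φ n ℓ U (suc i) <ᵇ 2 * φ n ℓ U i
  ... | false = z≤n
  ... | true  = ≤-refl

  no-carry⇒no-jump : ∀ i → carryCount i ≡ 0 → jump i ≡ 0
  no-carry⇒no-jump i C≡0 with φ n ℓ U (suc i) <ᵇ 2 * φ n ℓ U i in lt
  ... | false = refl
  ... | true  = ⊥-elim (<-irrefl doubling (<ᵇ⇒< _ _ (subst T (sym lt) tt)))
    where
      E≡0 : carrySum i ≡ 0
      E≡0 = n≤0⇒n≡0 (begin
        carrySum i                      ≤⟨ carrySum≤ i ⟩
        pred (2 ^ suc n) * carryCount i ≡⟨ cong (pred (2 ^ suc n) *_) C≡0 ⟩
        pred (2 ^ suc n) * 0            ≡⟨ *-zeroʳ (pred (2 ^ suc n)) ⟩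
        0                               ∎)
        where open ≤-Reasoning
      doubling : φ n ℓ U (suc i) ≡ 2 * φ n ℓ U i
      doubling = trans (sym (trans (cong (φ n ℓ U (suc i) +_) E≡0) (+-identityʳ _))) (φ-suc i)

  jump≤carryCount : ∀ i → jump i ≤ carryCount i
  jump≤carryCount i with carryCount i in C≡
  ... | zero  = ≤-reflexive (no-carry⇒no-jump i C≡)
  ... | suc _ = ≤-trans (jump≤1 i) (s≤s z≤n)

  module ExactJumps (jumps≡weight : jumpCount n ℓ U ≡ weight n U) where

    carryCount≤1 : ∀ i → carryCount i ≤ 1
    carryCount≤1 i = begin
      carryCount i       ≡⟨ carryCount-mod i ⟩
      carryCount (i % ℓ) ≡⟨ sym (sumUpTo-mono-≤-≡⇒≡ ℓ (λ j _ → jump≤carryCount j)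
                                   (trans jumps≡weight (sym sum-carryCount≡weight)) (i % ℓ) (m%n<n i ℓ)) ⟩
      jump (i % ℓ)       ≤⟨ jump≤1 (i % ℓ) ⟩
      1                  ∎
      where open ≤-Reasoning

    carrySum<2^[1+n] : ∀ i → carrySum i < 2 ^ suc n
    carrySum<2^[1+n] i = begin-strict
      carrySum i                     ≤⟨ carrySum≤ i ⟩
      pred (2 ^ suc n) * carryCount i ≤⟨ *-monoʳ-≤ (pred (2 ^ suc n)) (carryCount≤1 i) ⟩
      pred (2 ^ suc n) * 1           ≡⟨ *-identityʳ (pred (2 ^ suc n)) ⟩
      pred (2 ^ suc n)               <⟨ m≤pred[n]⇒suc[m]≤n {{m^n≢0 2 (suc n)}} ≤-refl ⟩
      2 ^ suc n                      ∎
      where open ≤-Reasoning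

    φ-drop : ∀ i → 2 * φ n ℓ U i < φ n ℓ U (suc i) + 2 ^ suc n
    φ-drop i = subst (_< φ n ℓ U (suc i) + 2 ^ suc n) (φ-suc i)
                     (+-monoʳ-< (φ n ℓ U (suc i)) (carrySum<2^[1+n] i))

    φ<2^[1+n] : ∀ i → φ n ℓ U i < 2 ^ suc n
    φ<2^[1+n] = periodic-drop-bounded (φ n ℓ U) ℓ (2 ^ suc n) φ-+period φ-drop

-- Blocks of the support

2^-*-bound : ∀ {n} t u {m} → 2 ^ u < m → 2 ^ t * m < 2 ^ suc n → t + u ≤ n
2^-*-bound {n} t u {m} 2^u<m 2^t*m<2^[1+n] = ≤-pred (2^-cancel-< (begin-strict
  2 ^ (t + u)     ≡⟨ ^-distribˡ-+-* 2 t u ⟩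
  2 ^ t * 2 ^ u   <⟨ *-monoʳ-< (2 ^ t) {{m^n≢0 2 t}} 2^u<m ⟩
  2 ^ t * m       <⟨ 2^t*m<2^[1+n] ⟩
  2 ^ suc n       ∎))
  where open ≤-Reasoning

consecutive-blocks : ∀ {n u t t′ m m′} → 2 ^ u < m → 2 ^ t * m < 2 ^ suc n →
  2 * (2 ^ t * m) < m′ + 2 ^ suc n → 2 ^ t′ * m′ < 2 ^ suc n →
  suc t ≤ n ∸ u ⊎ suc t + suc t′ ≤ n + 1
consecutive-blocks {n} {u} {t} {t′} {m} {m′} 2^u<m last<P drop next<P with suc t ≤? n ∸ u
... | yes short = inj₁ short
... | no  long  = inj₂ (begin
  suc t + suc t′      ≡⟨ cong suc (trans (+-suc t t′) (cong suc (+-comm t t′))) ⟩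
  suc (suc (t′ + t))  ≡⟨ cong suc (sym (+-suc t′ t)) ⟩
  suc (t′ + suc t)    ≤⟨ s≤s (2^-*-bound t′ (suc t) 2^[1+t]<m′ next<P) ⟩
  suc n               ≡⟨ +-comm 1 n ⟩
  n + 1               ∎)
  where
    open ≤-Reasoning
    t+u≡n : t + u ≡ n
    t+u≡n = ≤-antisym (2^-*-bound t u 2^u<m last<P) (begin
      n           ≤⟨ m≤n+m∸n n u ⟩
      u + (n ∸ u) ≤⟨ +-monoʳ-≤ u (≤-pred (≰⇒> long)) ⟩
      u + t       ≡⟨ +-comm u t ⟩
      t + u       ∎)
    2^[1+t]<m′ : 2 ^ suc t < m′
    2^[1+t]<m′ = +-cancelʳ-< (2 ^ suc n) _ _ (begin-strict
      2 ^ suc t + 2 * 2 ^ n             ≡⟨ cong (λ e → 2 ^ suc t + 2 * 2 ^ e) (sym t+u≡n) ⟩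
      2 * 2 ^ t + 2 * 2 ^ (t + u)       ≡⟨ cong (λ e → 2 * 2 ^ t + 2 * e) (^-distribˡ-+-* 2 t u) ⟩
      2 * 2 ^ t + 2 * (2 ^ t * 2 ^ u)   ≡⟨ solve 2 (λ a b → con 2 :* a :+ con 2 :* (a :* b)
                                                          := con 2 :* (a :* (con 1 :+ b))) refl (2 ^ t) (2 ^ u) ⟩
      2 * (2 ^ t * suc (2 ^ u))         ≤⟨ *-monoʳ-≤ 2 (*-monoʳ-≤ (2 ^ t) 2^u<m) ⟩
      2 * (2 ^ t * m)                   <⟨ drop ⟩
      m′ + 2 ^ suc n                    ∎)

nextIdx< : ∀ {w k} → k < w → nextIdx w k < w
nextIdx< {w} {k} k<w with suc k ≟ w
... | yes _   = ≤-trans (s≤s z≤n) k<w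
... | no  1+k≢w = ≤∧≢⇒< k<w 1+k≢w

after-block : ∀ c k (ls : ℕ → ℕ) .{{_ : NonZero (ls k)}} →
  suc (c + sumUpTo k ls + pred (ls k)) ≡ c + sumUpTo (suc k) ls
after-block c k ls = begin
  suc (c + sumUpTo k ls + pred (ls k)) ≡⟨ sym (+-suc _ (pred (ls k))) ⟩
  c + sumUpTo k ls + suc (pred (ls k)) ≡⟨ cong (c + sumUpTo k ls +_) (suc-pred (ls k)) ⟩
  c + sumUpTo k ls + ls k              ≡⟨ +-assoc c _ _ ⟩
  c + sumUpTo (suc k) ls               ∎
  where open ≡-Reasoning

cyclic-next-block : ∀ (f : ℕ → ℕ) {ℓ w} c k (ls : ℕ → ℕ) → (∀ j → f (j + ℓ) ≡ f j) →
  sumUpTo w ls ≡ ℓ → f (c + sumUpTo (suc k) ls) ≡ f (c + sumUpTo (nextIdx w k) ls)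
cyclic-next-block f {w = w} c k ls periodic Σls≡ℓ with suc k ≟ w
... | no  _    = refl
... | yes refl =
  trans (cong (λ s → f (c + s)) Σls≡ℓ) (trans (periodic c) (cong f (sym (+-identityʳ c))))

lemma2p3 : (n : ℕ) → 3 ≤ n → (ℓ : ℕ) → 1 ≤ ℓ →
    (U : Tuple n) → InE n ℓ U →
    (w : ℕ) → weight n U ≡ w → jumpCount n ℓ U ≡ w →
    (c : ℕ) (ns ls : ℕ → ℕ) →
    ((k : ℕ) → k < w → 1 ≤ ls k) →
    sumUpTo w ls ≡ ℓ →
    ((k t : ℕ) → k < w → t < ls k → φ n ℓ U (c + sumUpTo k ls + t) ≡ 2 ^ t * ns k) →
    (k u : ℕ) → k < w → 1 ≤ u → 2 ^ u < ns k →
    (ls k ≤ n ∸ u) ⊎ (ls k + ls (nextIdx w k) ≤ n + 1)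
lemma2p3 n _ ℓ ℓ>0 U U∈E w weight≡w jumps≡w c ns ls ls>0 Σls≡ℓ blocks k u k<w _ 2^u<nₖ =
  subst₂ (λ L L′ → L ≤ n ∸ u ⊎ L + L′ ≤ n + 1)
         (suc-pred (ls k) {{ls≢0 k<w}}) (suc-pred (ls k′) {{ls≢0 k′<w}})
    (consecutive-blocks {u = u} 2^u<nₖ (last<2^[1+n] k<w) drop (last<2^[1+n] k′<w))
  where
    open Support n ℓ {{>-nonZero ℓ>0}} U U∈E
    open ExactJumps (trans jumps≡w (sym weight≡w))
    k′ = nextIdx w k
    k′<w = nextIdx< k<w
    ls≢0 : ∀ {j} → j < w → NonZero (ls j)
    ls≢0 j<w = >-nonZero (ls>0 _ j<w)
    lastIdx : ℕ → ℕ
    lastIdx j = c + sumUpTo j ls + pred (ls j)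
    last-term : ∀ {j} → j < w → φ n ℓ U (lastIdx j) ≡ 2 ^ pred (ls j) * ns j
    last-term {j} j<w = blocks j (pred (ls j)) j<w (m≤pred[n]⇒suc[m]≤n {{ls≢0 j<w}} ≤-refl)
    last<2^[1+n] : ∀ {j} → j < w → 2 ^ pred (ls j) * ns j < 2 ^ suc n
    last<2^[1+n] {j} j<w = subst (_< 2 ^ suc n) (last-term j<w) (φ<2^[1+n] (lastIdx j))
    first-term-next : φ n ℓ U (suc (lastIdx k)) ≡ ns k′
    first-term-next = begin
      φ n ℓ U (suc (lastIdx k))        ≡⟨ cong (φ n ℓ U) (after-block c k ls {{ls≢0 k<w}}) ⟩
      φ n ℓ U (c + sumUpTo (suc k) ls) ≡⟨ cyclic-next-block (φ n ℓ U) {w = w} c k ls φ-+period Σls≡ℓ ⟩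
      φ n ℓ U (c + sumUpTo k′ ls)      ≡⟨ cong (φ n ℓ U) (sym (+-identityʳ (c + sumUpTo k′ ls))) ⟩
      φ n ℓ U (c + sumUpTo k′ ls + 0)  ≡⟨ blocks k′ 0 k′<w (ls>0 k′ k′<w) ⟩
      2 ^ 0 * ns k′                    ≡⟨ *-identityˡ (ns k′) ⟩
      ns k′                            ∎
      where open ≡-Reasoning
    drop : 2 * (2 ^ pred (ls k) * ns k) < ns k′ + 2 ^ suc n
    drop = subst₂ (λ x y → 2 * x < y + 2 ^ suc n) (last-term k<w) first-term-next (φ-drop (lastIdx k))
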